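{- Let $n\ge1$ and let $G$ be the graph obtained from the complete graph $K_n$ on vertex set $\{1,\ldots,n\}$ by attaching, for each $i\in\{1,\ldots,n\}$, a (possibly empty) set $S_i$ of pendant vertices, each adjacent only to $i$; the sets $S_i$ are pairwise disjoint, $V(G)=\{1,\ldots,N\}$ with $N=n+\sum_i|S_i|$, and every vertex of every $S_i$ has label greater than $n$. Then the intervals $[A\setminus Int(A);A\cup Ext(A)]$, $A$ ranging over the maximal independent sets of $G$, form a partition of $2^{V(G)}$ if and only if either (1) $|S_i|>0$ for all $i=1,\ldots,n$, or (2) the set $B=\{i\in\{1,\ldots,n\}: |S_i|=0\}$ is nonempty and $n\in B$.
   Context: The labels give the linear order on the vertex set. For an independent set $A$: $Ext(A)=\{u\notin A:\ \exists a\in A,\ a\in N(u),\ u>a\}$; for $u\in A$, $Subs(u)=\{w\in N(u): (A\setminus\{u\})\cup\{w\}\text{ independent}\}$, $u$ is internally active if $Subs(u)=\emptyset$ or $u>\max Subs(u)$; $Int(A)$ is the set of internally active vertices of $A$. $[X;Y]=\{Z: X\subseteq Z\subseteq Y\}$. A family of intervals forms a partition if the intervals (for distinct maximal independent sets) are pairwise disjoint and their union is the whole power set. -}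

module Defs where

open import Data.Nat using (ℕ; suc; _+_)
open import Data.Fin using (Fin; _<_; splitAt; fromℕ)
open import Data.Fin.Subset using (Subset; _∈_; _∉_)
open import Data.Sum using (_⊎_; inj₁; inj₂)
open import Data.Product using (Σ; ∃; _×_)
open import Data.Empty using (⊥)
open import Relation.Nullary using (¬_)
open import Relation.Binary.PropositionalEquality using (_≡_; _≢_)

-- Labels are 0-based here (vertex i of the paper is Fin element i-1);
-- this shift does not change the order.

module _ {N : ℕ} (Adj : Fin N → Fin N → Set) where

  IndependentP : (Fin N → Set) → Set
  IndependentP P = ∀ u v → P u → P v → ¬ Adj u v

  Independent : Subset N → Set
  Independent A = IndependentP (_∈ A)

  MaximalIndependent : Subset N → Set
  MaximalIndependent A =
    Independent A × (∀ B → Independent B → (∀ x → x ∈ A → x ∈ B) → ∀ x → x ∈ B → x ∈ A)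

  InExt : Subset N → Fin N → Set
  InExt A u = u ∉ A × ∃ λ a → a ∈ A × Adj u a × a < u

  InSubs : Subset N → Fin N → Fin N → Set
  InSubs A u w = Adj u w × IndependentP (λ x → (x ∈ A × x ≢ u) ⊎ x ≡ w)

  -- u ∈ Int(A): u ∈ A and (Subs(u) = ∅ or u > max Subs(u)),
  -- i.e. every element of Subs(u) is smaller than u
  InInt : Subset N → Fin N → Set
  InInt A u = u ∈ A × (∀ w → InSubs A u w → w < u)

  InInterval : Subset N → Subset N → Set
  InInterval A Z =
    (∀ x → x ∈ A → ¬ InInt A x → x ∈ Z) × (∀ x → x ∈ Z → x ∈ A ⊎ InExt A x)

  IntervalsPartition : Set
  IntervalsPartition =
    (∀ Z → ∃ λ A → MaximalIndependent A × InInterval A Z) ×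
    (∀ Z A A′ → MaximalIndependent A → MaximalIndependent A′ →
       InInterval A Z → InInterval A′ Z → A ≡ A′)

-- The graph of the theorem: K_n on the first n vertices (n = suc n′),
-- and m pendant vertices (labels n+1..n+m in the paper); pendant k is
-- attached to clique vertex f k.  So S_i = { pendant k | f k ≡ i }.

CliqueWithPendants : ∀ n m → (Fin m → Fin n) → Fin (n + m) → Fin (n + m) → Set
CliqueWithPendants n m f u v with splitAt n u | splitAt n v
... | inj₁ i | inj₁ j = i ≢ j
... | inj₁ i | inj₂ k = f k ≡ i
... | inj₂ k | inj₁ i = f k ≡ i
... | inj₂ k | inj₂ l = ⊥

AllPendantsNonempty : ∀ n m → (Fin m → Fin n) → Set
AllPendantsNonempty n m f = ∀ i → ∃ λ k → f k ≡ i

InB : ∀ n m → (Fin m → Fin n) → Fin n → Set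
InB n m f i = ∀ k → f k ≢ i

-- condition (2): B nonempty and n ∈ B (n = the largest clique vertex, fromℕ n′)
Condition2 : ∀ n′ m → (Fin m → Fin (suc n′)) → Set
Condition2 n′ m f = (∃ λ i → InB (suc n′) m f i) × InB (suc n′) m f (fromℕ n′)

-- The maximal independent sets are A_i = {i} ∪ (pendants not attached to i), one for each
-- clique vertex i, and, when every S_i is nonempty, the set of all pendants. A pendant is always
-- internally active (its only neighbour is smaller), while a clique vertex i ∈ A is not as soon as
-- S_i ≠ ∅ or some vertex of B exceeds i. Hence under (1) or (2), if Z lies in the intervals of A
-- and A′, then A contains a clique vertex iff A′ does, and it is the least clique vertex of Z, or
-- n if Z has none; as a maximal independent set is determined by its clique vertex, A = A′. The
-- same analysis shows that Z lies in the interval of A_i for the least clique vertex i of Z, and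
-- otherwise in that of the all-pendant set under (1), or of A_n under (2). If both conditions fail
-- then B ≠ ∅ and S_n ≠ ∅: the interval containing ∅ belongs to some A with a clique vertex i ≠ n,
-- and {n} then lies in the intervals of both A and A_n.
module Submission where

open import Defs
open import Data.Empty using (⊥-elim)
open import Data.Fin as F using (Fin; _↑ˡ_; _↑ʳ_; toℕ; fromℕ; fromℕ<; splitAt; inject)
open import Data.Fin.Properties
  using (splitAt-↑ˡ; splitAt-↑ʳ; join-splitAt; toℕ-↑ˡ; toℕ-↑ʳ; toℕ<n; toℕ-injective; toℕ-inject;
         toℕ-fromℕ<; ↑ˡ-injective; ≤fromℕ; ≤-antisym; ≤-reflexive; ≤∧≢⇒<; <-asym; <-irrefl; any?; all?;
         ¬∀⟶∃¬; ¬∀⟶∃¬-smallest)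
open import Data.Fin.Subset as S using (Subset; _∈_; _∉_; _⊆_; ⁅_⁆)
open import Data.Fin.Subset.Properties
  using (_∈?_; ⊆-antisym; x∈p∪q⁺; x∈p∪q⁻; x∈⁅x⁆; x∈⁅y⁆⇒x≡y; ∉⊥; ∈⊤)
open import Data.Nat using (ℕ; suc; _+_)
import Data.Nat.Properties as ℕ
open import Data.Product using (∃; _×_; _,_; proj₁; proj₂)
open import Data.Sum using (_⊎_; inj₁; inj₂)
open import Data.Vec using (tabulate; _++_)
open import Data.Vec.Properties using (lookup∘tabulate; []=⇒lookup; lookup⇒[]=; lookup-++ˡ; lookup-++ʳ)
open import Function.Bundles using (_⇔_; mk⇔)
open import Relation.Binary.PropositionalEquality using (_≡_; _≢_; refl; sym; trans; cong; subst)
open import Relation.Nullary using (¬_; yes; no; does)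
open import Relation.Nullary.Decidable using (dec-true; decidable-stable; ¬?)
open import Relation.Nullary.Negation using (contradiction)
open import Relation.Unary using (Pred; Decidable)

module _ {N : ℕ} {Adj : Fin N → Fin N → Set}
         (adj-sym : ∀ u v → Adj u v → Adj v u) (adj-irrefl : ∀ u → ¬ Adj u u) where

  maximal-absorbs : ∀ {A} → MaximalIndependent Adj A →
                    ∀ x → (∀ y → y ∈ A → ¬ Adj x y) → x ∈ A
  maximal-absorbs {A} (indA , maxA) x x-isolated =
    maxA (A S.∪ ⁅ x ⁆) independent (λ y y∈A → x∈p∪q⁺ (inj₁ y∈A)) x (x∈p∪q⁺ (inj₂ (x∈⁅x⁆ x)))
    where
    independent : Independent Adj (A S.∪ ⁅ x ⁆)
    independent u v u∈ v∈ uv with x∈p∪q⁻ A ⁅ x ⁆ u∈ | x∈p∪q⁻ A ⁅ x ⁆ v∈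
    ... | inj₁ u∈A | inj₁ v∈A = indA u v u∈A v∈A uv
    ... | inj₁ u∈A | inj₂ v≡x rewrite x∈⁅y⁆⇒x≡y x v≡x = x-isolated u u∈A (adj-sym u x uv)
    ... | inj₂ u≡x | inj₁ v∈A rewrite x∈⁅y⁆⇒x≡y x u≡x = x-isolated v v∈A uv
    ... | inj₂ u≡x | inj₂ v≡x rewrite x∈⁅y⁆⇒x≡y x u≡x | x∈⁅y⁆⇒x≡y x v≡x = adj-irrefl x uv

module _ {n ℓ} {P : Pred (Fin n) ℓ} (P? : Decidable P) where

  fromDec : Subset n
  fromDec = tabulate (λ x → does (P? x))

  ∈-fromDec⁺ : ∀ {x} → P x → x ∈ fromDec
  ∈-fromDec⁺ {x} px = lookup⇒[]= x fromDec (trans (lookup∘tabulate _ x) (dec-true (P? x) px))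

  ∈-fromDec⁻ : ∀ {x} → x ∈ fromDec → P x
  ∈-fromDec⁻ {x} x∈ with P? x | trans (sym (lookup∘tabulate _ x)) ([]=⇒lookup x∈)
  ... | yes px | _ = px
  ... | no _ | ()

  least : (∃ λ x → P x) → ∃ λ i → P i × (∀ j → P j → i F.≤ j)
  least (x , px) with ¬∀⟶∃¬-smallest n (λ i → ¬ P i) (λ i → ¬? (P? i)) (λ none → none x px)
  ... | i , ¬¬pi , below-i = i , decidable-stable (P? i) ¬¬pi , minimal
    where
    minimal : ∀ j → P j → i F.≤ j
    minimal j pj = ℕ.≮⇒≥ λ j<i → below-i (fromℕ< j<i) (subst P (sym (inject-fromℕ< j<i)) pj)
      where
      inject-fromℕ< : (j<i : j F.< i) → inject (fromℕ< j<i) ≡ j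
      inject-fromℕ< j<i = toℕ-injective (trans (toℕ-inject (fromℕ< j<i)) (toℕ-fromℕ< j<i))

module _ {n m} (p : Subset n) (q : Subset m) where

  ∈-++ˡ⁺ : ∀ {i} → i ∈ p → i ↑ˡ m ∈ p ++ q
  ∈-++ˡ⁺ {i} i∈p = lookup⇒[]= _ (p ++ q) (trans (lookup-++ˡ p q i) ([]=⇒lookup i∈p))

  ∈-++ˡ⁻ : ∀ {i} → i ↑ˡ m ∈ p ++ q → i ∈ p
  ∈-++ˡ⁻ {i} i∈ = lookup⇒[]= i p (trans (sym (lookup-++ˡ p q i)) ([]=⇒lookup i∈))

  ∈-++ʳ⁺ : ∀ {k} → k ∈ q → n ↑ʳ k ∈ p ++ q
  ∈-++ʳ⁺ {k} k∈q = lookup⇒[]= _ (p ++ q) (trans (lookup-++ʳ p q k) ([]=⇒lookup k∈q))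

  ∈-++ʳ⁻ : ∀ {k} → n ↑ʳ k ∈ p ++ q → k ∈ q
  ∈-++ʳ⁻ {k} k∈ = lookup⇒[]= k q (trans (sym (lookup-++ʳ p q k)) ([]=⇒lookup k∈))

module CliqueWithPendantsGraph (n′ m : ℕ) (f : Fin m → Fin (suc n′)) where

  n : ℕ
  n = suc n′

  V : Set
  V = Fin (n + m)

  G : V → V → Set
  G = CliqueWithPendants n m f

  clique : Fin n → V
  clique i = i ↑ˡ m

  pendant : Fin m → V
  pendant k = n ↑ʳ k

  data View : V → Set where
    clique-view  : ∀ i → View (clique i)
    pendant-view : ∀ k → View (pendant k)

  view : ∀ x → View x
  view x with splitAt n x | join-splitAt n m x
  ... | inj₁ i | refl = clique-view i
  ... | inj₂ k | refl = pendant-view k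

  adj-cc⁺ : ∀ i j → i ≢ j → G (clique i) (clique j)
  adj-cc⁺ i j i≢j rewrite splitAt-↑ˡ n i m | splitAt-↑ˡ n j m = i≢j

  adj-cc⁻ : ∀ i j → G (clique i) (clique j) → i ≢ j
  adj-cc⁻ i j adj rewrite splitAt-↑ˡ n i m | splitAt-↑ˡ n j m = adj

  adj-cp⁺ : ∀ i k → f k ≡ i → G (clique i) (pendant k)
  adj-cp⁺ i k fk≡i rewrite splitAt-↑ˡ n i m | splitAt-↑ʳ n m k = fk≡i

  adj-cp⁻ : ∀ i k → G (clique i) (pendant k) → f k ≡ i
  adj-cp⁻ i k adj rewrite splitAt-↑ˡ n i m | splitAt-↑ʳ n m k = adj

  adj-pc⁺ : ∀ k i → f k ≡ i → G (pendant k) (clique i)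
  adj-pc⁺ k i fk≡i rewrite splitAt-↑ˡ n i m | splitAt-↑ʳ n m k = fk≡i

  adj-pc⁻ : ∀ k i → G (pendant k) (clique i) → f k ≡ i
  adj-pc⁻ k i adj rewrite splitAt-↑ˡ n i m | splitAt-↑ʳ n m k = adj

  ¬adj-pp : ∀ k l → ¬ G (pendant k) (pendant l)
  ¬adj-pp k l adj rewrite splitAt-↑ʳ n m k | splitAt-↑ʳ n m l = adj

  adj-sym : ∀ u v → G u v → G v u
  adj-sym u v adj with view u | view v
  ... | clique-view i  | clique-view j  = adj-cc⁺ j i (λ j≡i → adj-cc⁻ i j adj (sym j≡i))
  ... | clique-view i  | pendant-view k = adj-pc⁺ k i (adj-cp⁻ i k adj)
  ... | pendant-view k | clique-view i  = adj-cp⁺ i k (adj-pc⁻ k i adj)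
  ... | pendant-view k | pendant-view l = ⊥-elim (¬adj-pp k l adj)

  adj-irrefl : ∀ u → ¬ G u u
  adj-irrefl u adj with view u
  ... | clique-view i  = adj-cc⁻ i i adj refl
  ... | pendant-view k = ¬adj-pp k k adj

  clique<pendant : ∀ i k → clique i F.< pendant k
  clique<pendant i k rewrite toℕ-↑ˡ i m | toℕ-↑ʳ n k = ℕ.<-≤-trans (toℕ<n i) (ℕ.m≤m+n n (toℕ k))

  clique-<⁺ : ∀ i j → i F.< j → clique i F.< clique j
  clique-<⁺ i j i<j rewrite toℕ-↑ˡ i m | toℕ-↑ˡ j m = i<j

  clique-<⁻ : ∀ i j → clique i F.< clique j → i F.< j
  clique-<⁻ i j i<j rewrite toℕ-↑ˡ i m | toℕ-↑ˡ j m = i<j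

  pendant≢clique : ∀ k i → pendant k ≢ clique i
  pendant≢clique k i eq = <-irrefl (sym eq) (clique<pendant i k)

  last : Fin n
  last = fromℕ n′

  Condition : Set
  Condition = AllPendantsNonempty n m f ⊎ Condition2 n′ m f

  NonClique : V → Set
  NonClique x = ∀ j → x ≢ clique j

  nonClique-independent : (P : V → Set) → (∀ x → P x → NonClique x) → IndependentP G P
  nonClique-independent P nonClique u v pu pv adj with view u | view v
  ... | clique-view i  | _              = nonClique _ pu i refl
  ... | pendant-view k | clique-view j  = nonClique _ pv j refl
  ... | pendant-view k | pendant-view l = ¬adj-pp k l adj

  pendant-internallyActive : ∀ {A} k → pendant k ∈ A → InInt G A (pendant k)
  pendant-internallyActive {A} k pk∈A = pk∈A , below
    where
    below : ∀ w → InSubs G A (pendant k) w → w F.< pendant k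
    below w (adj , _) with view w
    ... | clique-view j  = clique<pendant j k
    ... | pendant-view l = contradiction adj (¬adj-pp k l)

  module _ {A : Subset (n + m)} (indA : Independent G A) where

    clique-unique : ∀ i j → clique i ∈ A → clique j ∈ A → i ≡ j
    clique-unique i j ci∈A cj∈A with i F.≟ j
    ... | yes i≡j = i≡j
    ... | no i≢j  = contradiction (adj-cc⁺ i j i≢j) (indA _ _ ci∈A cj∈A)

    others-nonClique : ∀ i x → clique i ∈ A → x ∈ A → x ≢ clique i → NonClique x
    others-nonClique i x ci∈A x∈A x≢ci j refl = x≢ci (cong clique (clique-unique j i x∈A ci∈A))

    attached∈Subs : ∀ i k → clique i ∈ A → f k ≡ i → InSubs G A (clique i) (pendant k)
    attached∈Subs i k ci∈A fk≡i = adj-cp⁺ i k fk≡i , nonClique-independent _ nonClique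
      where
      nonClique : ∀ x → (x ∈ A × x ≢ clique i) ⊎ x ≡ pendant k → NonClique x
      nonClique x (inj₁ (x∈A , x≢ci)) = others-nonClique i x ci∈A x∈A x≢ci
      nonClique x (inj₂ refl) j       = pendant≢clique k j

    B∈Subs : ∀ i j → clique i ∈ A → InB n m f j → j ≢ i → InSubs G A (clique i) (clique j)
    B∈Subs i j ci∈A j∈B j≢i = adj-cc⁺ i j (λ i≡j → j≢i (sym i≡j)) , independent
      where
      ¬adj-cj : ∀ u → u ∈ A → u ≢ clique i → ¬ G u (clique j)
      ¬adj-cj u u∈A u≢ci adj with view u
      ... | clique-view l  = others-nonClique i (clique l) ci∈A u∈A u≢ci l refl
      ... | pendant-view k = j∈B k (adj-pc⁻ k j adj)

      independent : IndependentP G (λ x → (x ∈ A × x ≢ clique i) ⊎ x ≡ clique j)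
      independent u v (inj₁ (u∈A , _))   (inj₁ (v∈A , _))   adj = indA u v u∈A v∈A adj
      independent u v (inj₁ (u∈A , u≢ci)) (inj₂ refl)        adj = ¬adj-cj u u∈A u≢ci adj
      independent u v (inj₂ refl)        (inj₁ (v∈A , v≢ci)) adj = ¬adj-cj v v∈A v≢ci (adj-sym u v adj)
      independent u v (inj₂ refl)        (inj₂ refl)        adj = adj-irrefl u adj

    attached⇒¬internallyActive : ∀ i k → clique i ∈ A → f k ≡ i → ¬ InInt G A (clique i)
    attached⇒¬internallyActive i k ci∈A fk≡i (_ , below) =
      <-asym (below _ (attached∈Subs i k ci∈A fk≡i)) (clique<pendant i k)

    largerB⇒¬internallyActive : ∀ i j → clique i ∈ A → InB n m f j → i F.< j →
                                ¬ InInt G A (clique i)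
    largerB⇒¬internallyActive i j ci∈A j∈B i<j (_ , below) =
      <-asym (below _ (B∈Subs i j ci∈A j∈B (λ j≡i → <-irrefl (sym j≡i) i<j))) (clique-<⁺ i j i<j)

    condition⇒¬internallyActive : Condition → ∀ i → clique i ∈ A → i ≢ last →
                                  ¬ InInt G A (clique i)
    condition⇒¬internallyActive (inj₁ allPendants) i ci∈A _ =
      attached⇒¬internallyActive i _ ci∈A (proj₂ (allPendants i))
    condition⇒¬internallyActive (inj₂ (_ , last∈B)) i ci∈A i≢last =
      largerB⇒¬internallyActive i last ci∈A last∈B (≤∧≢⇒< (≤fromℕ i) i≢last)

    ext-clique : ∀ i j → clique i ∈ A → InExt G A (clique j) → i F.< j
    ext-clique i j ci∈A (_ , a , a∈A , _ , a<cj) with view a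
    ... | clique-view l  = subst (F._< j) (clique-unique l i a∈A ci∈A) (clique-<⁻ l j a<cj)
    ... | pendant-view k = contradiction a<cj (<-asym (clique<pendant j k))

    larger-clique∈Ext : ∀ i j → clique i ∈ A → i F.< j → InExt G A (clique j)
    larger-clique∈Ext i j ci∈A i<j =
      (λ cj∈A → <-irrefl (clique-unique i j ci∈A cj∈A) i<j) ,
      clique i , ci∈A , adj-cc⁺ j i (λ j≡i → <-irrefl (sym j≡i) i<j) , clique-<⁺ i j i<j

  last-internallyActive : ∀ {A} → InB n m f last → clique last ∈ A → InInt G A (clique last)
  last-internallyActive last∈B clast∈A = clast∈A , below
    where
    below : ∀ w → InSubs G _ (clique last) w → w F.< clique last
    below w (adj , _) with view w
    ... | clique-view l  =
      clique-<⁺ l last (≤∧≢⇒< (≤fromℕ l) (λ l≡last → adj-cc⁻ last l adj (sym l≡last)))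
    ... | pendant-view k = contradiction (adj-cp⁻ last k adj) (last∈B k)

  clique∈Ext⇒hasClique : ∀ {A} j → InExt G A (clique j) → ∃ λ l → clique l ∈ A
  clique∈Ext⇒hasClique j (_ , a , a∈A , _ , a<cj) with view a
  ... | clique-view l  = l , a∈A
  ... | pendant-view k = contradiction a<cj (<-asym (clique<pendant j k))

  B⇒hasClique : ∀ {A} b → InB n m f b → MaximalIndependent G A → ∃ λ i → clique i ∈ A
  B⇒hasClique {A} b b∈B misA with any? (λ j → clique j ∈? A)
  ... | yes hasClique = hasClique
  ... | no cliqueFree = contradiction (b , maximal-absorbs adj-sym adj-irrefl misA (clique b) isolated) cliqueFree
    where
    isolated : ∀ y → y ∈ A → ¬ G (clique b) y
    isolated y y∈A adj with view y
    ... | clique-view l  = cliqueFree (l , y∈A)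
    ... | pendant-view k = b∈B k (adj-cp⁻ b k adj)

  maximal-⊆ : ∀ {A A′} → MaximalIndependent G A → MaximalIndependent G A′ →
              (∀ i → clique i ∈ A → clique i ∈ A′) → (∀ i → clique i ∈ A′ → clique i ∈ A) → A ⊆ A′
  maximal-⊆ {A} {A′} misA misA′ A→A′ A′→A {x} x∈A with view x
  ... | clique-view i  = A→A′ i x∈A
  ... | pendant-view k = maximal-absorbs adj-sym adj-irrefl misA′ (pendant k) isolated
    where
    isolated : ∀ y → y ∈ A′ → ¬ G (pendant k) y
    isolated y y∈A′ adj with view y
    ... | clique-view j  = proj₁ misA (pendant k) (clique j) x∈A (A′→A j y∈A′) adj
    ... | pendant-view l = ¬adj-pp k l adj

  detached? : ∀ i → Decidable (λ k → f k ≢ i)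
  detached? i k = ¬? (f k F.≟ i)

  cliqueMIS : Fin n → Subset (n + m)
  cliqueMIS i = ⁅ i ⁆ ++ fromDec (detached? i)

  pendantMIS : Subset (n + m)
  pendantMIS = S.⊥ {n} ++ S.⊤ {m}

  clique∈cliqueMIS : ∀ i → clique i ∈ cliqueMIS i
  clique∈cliqueMIS i = ∈-++ˡ⁺ ⁅ i ⁆ _ (x∈⁅x⁆ i)

  clique∈cliqueMIS⁻ : ∀ i j → clique j ∈ cliqueMIS i → j ≡ i
  clique∈cliqueMIS⁻ i j cj∈ = x∈⁅y⁆⇒x≡y i (∈-++ˡ⁻ ⁅ i ⁆ _ cj∈)

  pendant∈cliqueMIS⁺ : ∀ i k → f k ≢ i → pendant k ∈ cliqueMIS i
  pendant∈cliqueMIS⁺ i k fk≢i = ∈-++ʳ⁺ ⁅ i ⁆ _ (∈-fromDec⁺ (detached? i) fk≢i)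

  pendant∈cliqueMIS⁻ : ∀ i k → pendant k ∈ cliqueMIS i → f k ≢ i
  pendant∈cliqueMIS⁻ i k pk∈ = ∈-fromDec⁻ (detached? i) (∈-++ʳ⁻ ⁅ i ⁆ _ pk∈)

  clique∉pendantMIS : ∀ j → clique j ∉ pendantMIS
  clique∉pendantMIS j cj∈ = ∉⊥ (∈-++ˡ⁻ S.⊥ (S.⊤ {m}) cj∈)

  pendant∈pendantMIS : ∀ k → pendant k ∈ pendantMIS
  pendant∈pendantMIS k = ∈-++ʳ⁺ (S.⊥ {n}) S.⊤ ∈⊤

  cliqueMIS-maximal : ∀ i → MaximalIndependent G (cliqueMIS i)
  cliqueMIS-maximal i = independent , maximal
    where
    independent : Independent G (cliqueMIS i)
    independent u v u∈ v∈ adj with view u | view v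
    ... | clique-view j  | clique-view l  =
      adj-cc⁻ j l adj (trans (clique∈cliqueMIS⁻ i j u∈) (sym (clique∈cliqueMIS⁻ i l v∈)))
    ... | clique-view j  | pendant-view k =
      pendant∈cliqueMIS⁻ i k v∈ (trans (adj-cp⁻ j k adj) (clique∈cliqueMIS⁻ i j u∈))
    ... | pendant-view k | clique-view j  =
      pendant∈cliqueMIS⁻ i k u∈ (trans (adj-pc⁻ k j adj) (clique∈cliqueMIS⁻ i j v∈))
    ... | pendant-view k | pendant-view l = ¬adj-pp k l adj

    maximal : ∀ B → Independent G B → (∀ x → x ∈ cliqueMIS i → x ∈ B) → ∀ x → x ∈ B → x ∈ cliqueMIS i
    maximal B indB ⊆B x x∈B with view x
    ... | clique-view j with j F.≟ i
    ...   | yes refl = clique∈cliqueMIS i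
    ...   | no j≢i   = contradiction (adj-cc⁺ j i j≢i) (indB _ _ x∈B (⊆B _ (clique∈cliqueMIS i)))
    maximal B indB ⊆B x x∈B | pendant-view k with f k F.≟ i
    ...   | yes fk≡i = contradiction (adj-pc⁺ k i fk≡i) (indB _ _ x∈B (⊆B _ (clique∈cliqueMIS i)))
    ...   | no fk≢i  = pendant∈cliqueMIS⁺ i k fk≢i

  pendantMIS-maximal : AllPendantsNonempty n m f → MaximalIndependent G pendantMIS
  pendantMIS-maximal allPendants = independent , maximal
    where
    independent : Independent G pendantMIS
    independent = nonClique-independent _ λ x x∈ j x≡cj → clique∉pendantMIS j (subst (_∈ pendantMIS) x≡cj x∈)

    maximal : ∀ B → Independent G B → (∀ x → x ∈ pendantMIS → x ∈ B) → ∀ x → x ∈ B → x ∈ pendantMIS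
    maximal B indB ⊆B x x∈B with view x
    ... | pendant-view k = pendant∈pendantMIS k
    ... | clique-view j with allPendants j
    ...   | k , fk≡j = contradiction (adj-cp⁺ j k fk≡j) (indB _ _ x∈B (⊆B _ (pendant∈pendantMIS k)))

  cliqueMIS-lower : ∀ i x → x ∈ cliqueMIS i → ¬ InInt G (cliqueMIS i) x → x ≡ clique i
  cliqueMIS-lower i x x∈ ¬active with view x
  ... | clique-view j  = cong clique (clique∈cliqueMIS⁻ i j x∈)
  ... | pendant-view k = contradiction (pendant-internallyActive k x∈) ¬active

  cliqueMIS-upper-clique : ∀ i j → i F.≤ j → clique j ∈ cliqueMIS i ⊎ InExt G (cliqueMIS i) (clique j)
  cliqueMIS-upper-clique i j i≤j with j F.≟ i
  ... | yes refl = inj₁ (clique∈cliqueMIS i)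
  ... | no j≢i   = inj₂ (larger-clique∈Ext (proj₁ (cliqueMIS-maximal i)) i j (clique∈cliqueMIS i)
                                             (≤∧≢⇒< i≤j (λ i≡j → j≢i (sym i≡j))))

  cliqueMIS-upper-pendant : ∀ i k → pendant k ∈ cliqueMIS i ⊎ InExt G (cliqueMIS i) (pendant k)
  cliqueMIS-upper-pendant i k with f k F.≟ i
  ... | yes fk≡i = inj₂ ((λ pk∈ → pendant∈cliqueMIS⁻ i k pk∈ fk≡i) ,
                         clique i , clique∈cliqueMIS i , adj-pc⁺ k i fk≡i , clique<pendant i k)
  ... | no fk≢i  = inj₁ (pendant∈cliqueMIS⁺ i k fk≢i)

  cliqueMIS-interval : ∀ Z i → clique i ∈ Z → (∀ j → clique j ∈ Z → i F.≤ j) →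
                       InInterval G (cliqueMIS i) Z
  cliqueMIS-interval Z i ci∈Z minimal = lower , upper
    where
    lower : ∀ x → x ∈ cliqueMIS i → ¬ InInt G (cliqueMIS i) x → x ∈ Z
    lower x x∈ ¬active = subst (_∈ Z) (sym (cliqueMIS-lower i x x∈ ¬active)) ci∈Z

    upper : ∀ x → x ∈ Z → x ∈ cliqueMIS i ⊎ InExt G (cliqueMIS i) x
    upper x x∈Z with view x
    ... | clique-view j  = cliqueMIS-upper-clique i j (minimal j x∈Z)
    ... | pendant-view k = cliqueMIS-upper-pendant i k

  CoveredBy : Subset (n + m) → Set
  CoveredBy Z = ∃ λ A → MaximalIndependent G A × InInterval G A Z

  cliqueFree-covered : Condition → ∀ Z → (∀ j → clique j ∉ Z) → CoveredBy Z
  cliqueFree-covered (inj₁ allPendants) Z cliqueFree =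
    pendantMIS , pendantMIS-maximal allPendants , lower , upper
    where
    lower : ∀ x → x ∈ pendantMIS → ¬ InInt G pendantMIS x → x ∈ Z
    lower x x∈ ¬active with view x
    ... | clique-view j  = contradiction x∈ (clique∉pendantMIS j)
    ... | pendant-view k = contradiction (pendant-internallyActive k x∈) ¬active

    upper : ∀ x → x ∈ Z → x ∈ pendantMIS ⊎ InExt G pendantMIS x
    upper x x∈Z with view x
    ... | clique-view j  = contradiction x∈Z (cliqueFree j)
    ... | pendant-view k = inj₁ (pendant∈pendantMIS k)
  cliqueFree-covered (inj₂ (_ , last∈B)) Z cliqueFree =
    cliqueMIS last , cliqueMIS-maximal last , lower , upper
    where
    lower : ∀ x → x ∈ cliqueMIS last → ¬ InInt G (cliqueMIS last) x → x ∈ Z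
    lower x x∈ ¬active = contradiction (subst (InInt G (cliqueMIS last)) (sym x≡clast) clast-active) ¬active
      where
      x≡clast : x ≡ clique last
      x≡clast = cliqueMIS-lower last x x∈ ¬active
      clast-active : InInt G (cliqueMIS last) (clique last)
      clast-active = last-internallyActive last∈B (clique∈cliqueMIS last)

    upper : ∀ x → x ∈ Z → x ∈ cliqueMIS last ⊎ InExt G (cliqueMIS last) x
    upper x x∈Z with view x
    ... | clique-view j  = contradiction x∈Z (cliqueFree j)
    ... | pendant-view k = inj₁ (pendant∈cliqueMIS⁺ last k (last∈B k))

  covered : Condition → ∀ Z → CoveredBy Z
  covered cond Z with any? (λ j → clique j ∈? Z)
  ... | no cliqueFree = cliqueFree-covered cond Z (λ j cj∈Z → cliqueFree (j , cj∈Z))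
  ... | yes hasClique with least (λ j → clique j ∈? Z) hasClique
  ...   | i , ci∈Z , minimal = cliqueMIS i , cliqueMIS-maximal i , cliqueMIS-interval Z i ci∈Z minimal

  module _ {Z A} (indA : Independent G A) (ivA : InInterval G A Z) where

    interval-clique-≤ : ∀ i j → clique i ∈ A → clique j ∈ Z → i F.≤ j
    interval-clique-≤ i j ci∈A cj∈Z with proj₂ ivA (clique j) cj∈Z
    ... | inj₁ cj∈A   = ≤-reflexive (clique-unique indA i j ci∈A cj∈A)
    ... | inj₂ cj∈Ext = ℕ.<⇒≤ (ext-clique indA i j ci∈A cj∈Ext)

    interval-attached-clique∈ : ∀ i k → clique i ∈ A → f k ≡ i → clique i ∈ Z
    interval-attached-clique∈ i k ci∈A fk≡i =
      proj₁ ivA (clique i) ci∈A (attached⇒¬internallyActive indA i k ci∈A fk≡i)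

    interval-clique∉⇒last : Condition → ∀ i → clique i ∈ A → clique i ∉ Z → i ≡ last
    interval-clique∉⇒last cond i ci∈A ci∉Z with i F.≟ last
    ... | yes i≡last = i≡last
    ... | no i≢last  =
      contradiction (proj₁ ivA (clique i) ci∈A (condition⇒¬internallyActive indA cond i ci∈A i≢last)) ci∉Z

  module _ {Z A A′} (misA : MaximalIndependent G A) (misA′ : MaximalIndependent G A′)
           (ivA : InInterval G A Z) (ivA′ : InInterval G A′ Z) where

    -- If clique j ∉ Z then j is the top clique vertex, so i ≤ j holds in either case.
    intervals-clique-≤ : Condition → ∀ i j → clique i ∈ A → clique j ∈ A′ → i F.≤ j
    intervals-clique-≤ cond i j ci∈A cj∈A′ with clique j ∈? Z
    ... | yes cj∈Z = interval-clique-≤ (proj₁ misA) ivA i j ci∈A cj∈Z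
    ... | no cj∉Z  =
      subst (i F.≤_) (sym (interval-clique∉⇒last (proj₁ misA′) ivA′ cond j cj∈A′ cj∉Z)) (≤fromℕ i)

    intervals-hasClique : Condition → ∀ i → clique i ∈ A → ∃ λ j → clique j ∈ A′
    intervals-hasClique (inj₂ (_ , last∈B)) _ _ = B⇒hasClique last last∈B misA′
    intervals-hasClique (inj₁ allPendants) i ci∈A
      with proj₂ ivA′ (clique i) (interval-attached-clique∈ (proj₁ misA) ivA i _ ci∈A (proj₂ (allPendants i)))
    ... | inj₁ ci∈A′  = i , ci∈A′
    ... | inj₂ ci∈Ext = clique∈Ext⇒hasClique i ci∈Ext

  intervals-clique-⊆ : Condition → ∀ {Z A A′} → MaximalIndependent G A → MaximalIndependent G A′ →
                       InInterval G A Z → InInterval G A′ Z → ∀ i → clique i ∈ A → clique i ∈ A′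
  intervals-clique-⊆ cond misA misA′ ivA ivA′ i ci∈A
    with intervals-hasClique misA misA′ ivA ivA′ cond i ci∈A
  ... | j , cj∈A′ = subst (λ l → clique l ∈ _) (sym i≡j) cj∈A′
    where
    i≡j : i ≡ j
    i≡j = ≤-antisym (intervals-clique-≤ misA misA′ ivA ivA′ cond i j ci∈A cj∈A′)
                    (intervals-clique-≤ misA′ misA ivA′ ivA cond j i cj∈A′ ci∈A)

  intervals-disjoint : Condition → ∀ Z A A′ → MaximalIndependent G A → MaximalIndependent G A′ →
                       InInterval G A Z → InInterval G A′ Z → A ≡ A′
  intervals-disjoint cond Z A A′ misA misA′ ivA ivA′ =
    ⊆-antisym (maximal-⊆ misA misA′ A→A′ A′→A) (maximal-⊆ misA′ misA A′→A A→A′)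
    where
    A→A′ : ∀ i → clique i ∈ A → clique i ∈ A′
    A→A′ = intervals-clique-⊆ cond misA misA′ ivA ivA′
    A′→A : ∀ i → clique i ∈ A′ → clique i ∈ A
    A′→A = intervals-clique-⊆ cond misA′ misA ivA′ ivA

  ¬partition : ∀ b k → InB n m f b → f k ≡ last → ¬ IntervalsPartition G
  ¬partition b k b∈B fk≡last (covered , disjoint) with covered S.⊥
  ... | A , misA , lowerA , _ with B⇒hasClique b b∈B misA
  ...   | i , ci∈A with i F.≟ last
  ...     | yes refl = ∉⊥ (lowerA (clique i) ci∈A (attached⇒¬internallyActive (proj₁ misA) i k ci∈A fk≡last))
  ...     | no i≢last = i≢last (clique∈cliqueMIS⁻ last i (subst (clique i ∈_) A≡cliqueMIS ci∈A))
    where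
    Z : Subset (n + m)
    Z = ⁅ clique last ⁆

    ivA : InInterval G A Z
    ivA = (λ x x∈A ¬active → contradiction (lowerA x x∈A ¬active) ∉⊥) , upper
      where
      upper : ∀ x → x ∈ Z → x ∈ A ⊎ InExt G A x
      upper x x∈Z rewrite x∈⁅y⁆⇒x≡y _ x∈Z =
        inj₂ (larger-clique∈Ext (proj₁ misA) i last ci∈A (≤∧≢⇒< (≤fromℕ i) i≢last))

    ivLast : InInterval G (cliqueMIS last) Z
    ivLast = cliqueMIS-interval Z last (x∈⁅x⁆ _)
               (λ j cj∈Z → ≤-reflexive (sym (↑ˡ-injective m j last (x∈⁅y⁆⇒x≡y _ cj∈Z))))

    A≡cliqueMIS : A ≡ cliqueMIS last
    A≡cliqueMIS = disjoint Z A (cliqueMIS last) misA (cliqueMIS-maximal last) ivA ivLast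

  bare⇒InB : ∀ b → ¬ (∃ λ k → f k ≡ b) → InB n m f b
  bare⇒InB b bare k fk≡b = bare (k , fk≡b)

  partition⇒condition : IntervalsPartition G → Condition
  partition⇒condition partition with all? (λ i → any? (λ k → f k F.≟ i))
  ... | yes allPendants = inj₁ allPendants
  ... | no ¬allPendants with ¬∀⟶∃¬ n _ (λ i → any? (λ k → f k F.≟ i)) ¬allPendants
  ...   | b , b-bare with any? (λ k → f k F.≟ last)
  ...     | yes (k , fk≡last) = contradiction partition (¬partition b k (bare⇒InB b b-bare) fk≡last)
  ...     | no last-bare = inj₂ ((b , bare⇒InB b b-bare) , bare⇒InB last last-bare)

theorem9 : (n′ m : ℕ) (f : Fin m → Fin (suc n′)) →
    IntervalsPartition (CliqueWithPendants (suc n′) m f)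
      ⇔ (AllPendantsNonempty (suc n′) m f ⊎ Condition2 n′ m f)
theorem9 n′ m f = mk⇔ partition⇒condition (λ cond → covered cond , intervals-disjoint cond)
  where open CliqueWithPendantsGraph n′ m f
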